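{- Let $n\ge 1$ and $r\ge 1$. A weakly decreasing sequence $d=(d(1),\dots,d(n))$ of nonnegative integers is the degree partition of some $r$-graph on vertex set $[n]$ if and only if $d$ is majorized by some $r$-ideal partition of length $n$.
   Context: $S(n,r)$ is the set of $r$-element subsets of $[n]=\{1,\dots,n\}$; writing each as $(a_1<\dots<a_r)$, partially order $S(n,r)$ componentwise: $(a_1,\dots,a_r)\le(b_1,\dots,b_r)$ iff $a_i\le b_i$ for all $i$. An $r$-graph is a pair $([n],E)$ with $E\subseteq S(n,r)$; the degree of vertex $j$ is the number of edges containing $j$, the degree sequence is $(d_1,\dots,d_n)$ and the degree partition is the degree sequence rearranged in weakly decreasing order. An $r$-graph $([n],E)$ is an $r$-ideal if $E$ is an order ideal of $S(n,r)$ (i.e. $Y\in E$ and $X\le Y$ imply $X\in E$); the degree sequence of an $r$-ideal is called an $r$-ideal partition (it is weakly decreasing). For real sequences $a,b$ of length $n$ with $a[i],b[i]$ denoting the $i$-th largest components, $a$ majorizes $b$ if $\sum_{i=1}^k a[i]\ge\sum_{i=1}^k b[i]$ for $k=1,\dots,n$, with equality for $k=n$. -}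

module Defs where

open import Data.Nat using (ℕ; zero; suc; _+_; _≤_; _<_; _≥_)
open import Data.Nat.Properties using (≤-decTotalOrder)
open import Data.Fin using (Fin; toℕ)
open import Data.Fin.Properties using (_≟_)
open import Data.Vec using (Vec; lookup)
import Data.Vec.Membership.DecPropositional as VMem
open import Data.List using (List; []; _∷_; take; reverse; tabulate)
open import Data.Nat.ListAction using (sum)
open import Data.List.Membership.Propositional using (_∈_)
open import Data.List.Relation.Unary.All using (All)
open import Data.List.Relation.Unary.Unique.Propositional using (Unique)
open import Data.List.Sort ≤-decTotalOrder using (sort)
open import Data.Product using (Σ; _×_)
open import Relation.Nullary using (yes; no)
open import Relation.Binary.PropositionalEquality using (_≡_)
open import Function.Bundles using (_↔_; Inverse)

-- An r-element subset of [n] = Fin n, written as its elements in increasing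
-- order (a₁ < … < a_r), i.e. a strictly increasing vector of length r.
StrictlyIncreasing : ∀ {n r} → Vec (Fin n) r → Set
StrictlyIncreasing {n} {r} a =
  ∀ (i j : Fin r) → toℕ i < toℕ j → toℕ (lookup a i) < toℕ (lookup a j)

_≤S_ : ∀ {n r} → Vec (Fin n) r → Vec (Fin n) r → Set
_≤S_ {n} {r} a b = ∀ (i : Fin r) → toℕ (lookup a i) ≤ toℕ (lookup b i)

record RGraph (n r : ℕ) : Set where
  field
    edges  : List (Vec (Fin n) r)
    rsets  : All StrictlyIncreasing edges
    unique : Unique edges
open RGraph public

count∋ : ∀ {n r} → Fin n → List (Vec (Fin n) r) → ℕ
count∋ j [] = 0
count∋ {n} j (e ∷ es) with VMem._∈?_ (_≟_ {n}) j e
... | yes _ = suc (count∋ j es)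
... | no  _ = count∋ j es

degree : ∀ {n r} → RGraph n r → Fin n → ℕ
degree G j = count∋ j (edges G)

IsIdeal : ∀ {n r} → RGraph n r → Set
IsIdeal {n} {r} G =
  ∀ (X Y : Vec (Fin n) r) → StrictlyIncreasing X → Y ∈ edges G → X ≤S Y → X ∈ edges G

WeaklyDecreasing : ∀ {n} → (Fin n → ℕ) → Set
WeaklyDecreasing {n} d = ∀ (i j : Fin n) → toℕ i ≤ toℕ j → d j ≤ d i

-- d is the degree partition of G: the degree sequence of G rearranged in
-- weakly decreasing order equals d.  (For weakly decreasing d this means d is
-- a rearrangement of the degree sequence.)
IsDegreePartitionOf : ∀ {n r} → (Fin n → ℕ) → RGraph n r → Set
IsDegreePartitionOf {n} d G =
  WeaklyDecreasing d ×
  Σ (Fin n ↔ Fin n) (λ σ → ∀ i → d i ≡ degree G (Inverse.to σ i))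

IsRIdealPartition : (n r : ℕ) → (Fin n → ℕ) → Set
IsRIdealPartition n r p =
  Σ (RGraph n r) (λ G → IsIdeal G × (∀ i → p i ≡ degree G i))

decreasingList : ∀ {n} → (Fin n → ℕ) → List ℕ
decreasingList a = reverse (sort (tabulate a))

topSum : ∀ {n} → ℕ → (Fin n → ℕ) → ℕ
topSum k a = sum (take k (decreasingList a))

Majorizes : ∀ {n} → (Fin n → ℕ) → (Fin n → ℕ) → Set
Majorizes {n} a b =
  (∀ k → 1 ≤ k → k ≤ n → topSum k b ≤ topSum k a) × topSum n a ≡ topSum n b

{-# OPTIONS --safe #-}
module Submission where

-- Both directions compare prefix sums of degree sequences and change a graph locally at two
-- adjacent vertices i and i+1.  Swapping the labels i and i+1, or replacing i+1 by i in one
-- edge, moves degree towards the smaller index and so can only raise prefix sums.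
-- (⇒) Starting from a realisation of d, swapping labels sorts the degrees; then shifting edges
-- down, as long as the shifted edge is new, ends in a graph closed under these elementary
-- shifts, i.e. an ideal, whose degree sequence majorizes d.
-- (⇐) Starting from an ideal whose degree sequence p majorizes d: if p ≠ d there is an i with
-- p(i+1) < p(i) at which the prefix sum of p strictly exceeds that of d.  Counting shows that
-- some edge through i but not through i+1 can be shifted up to a new edge, which lowers that
-- prefix sum by one and keeps p majorizing d.
-- Both processes terminate because they strictly move the sum of all prefix sums.

open import Defs
import Data.Nat as ℕ
open import Data.Nat using (ℕ; zero; suc; _+_; _∸_; _≤_; _<_; z≤n; s≤s; _<?_; _≤?_)
open import Data.Nat.Properties hiding (_≟_)
open import Data.Nat.Induction using (<-wellFounded)
open import Data.Nat.ListAction using (sum)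
open import Data.Fin using (Fin; zero; suc; toℕ; inject₁; punchIn)
open import Data.Fin.Properties using (_≟_; toℕ<n; toℕ-injective; toℕ-inject₁; any?)
  renaming (suc-injective to sucᶠ-injective)
open import Data.Fin.Permutation using (Permutation; _⟨$⟩ʳ_; remove; punchIn-permute)
import Data.Fin.Permutation as Permutation
open import Data.Fin.Permutation.Components using (transpose; transpose-inverse)
open import Data.Vec using (Vec; []; _∷_; lookup) renaming (map to vmap)
open import Data.Vec.Properties using (lookup-map; map-cong; ≡-dec)
open import Data.Vec.Membership.Propositional.Properties using (∈-lookup) renaming (∈-map⁺ to ∈ᵥ-map⁺)
import Data.Vec.Membership.DecPropositional as VecMembership
open import Data.Vec.Relation.Unary.Any using (here; there; index)
open import Data.Vec.Relation.Unary.Any.Properties using (lookup-index)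
open import Data.List using (List; []; _∷_; _++_; map; filter; length; take; reverse; tabulate)
open import Data.List.Properties using (tabulate-cong; reverse-involutive; unfold-reverse)
open import Data.List.Sort ≤-decTotalOrder using (sort; sort-↭; sort-↗)
open import Data.List.Membership.Propositional using (_∈_; _∉_; find; lose)
open import Data.List.Membership.Propositional.Properties using (∈-∃++; ∈-map⁻)
import Data.List.Membership.DecPropositional as EdgeMembership
import Data.List.Relation.Unary.Any as Any
open import Data.List.Relation.Unary.All as All using (All; _∷_)
import Data.List.Relation.Unary.All.Properties as All
open import Data.List.Relation.Unary.AllPairs as AllPairs using (AllPairs; []; _∷_)
import Data.List.Relation.Unary.AllPairs.Properties as AllPairs
open import Data.List.Relation.Unary.Unique.Propositional using (Unique)
import Data.List.Relation.Unary.Unique.Propositional.Properties as Unique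
open import Data.List.Relation.Unary.Linked.Properties using (AllPairs⇒Linked)
open import Data.List.Relation.Unary.Sorted.TotalOrder.Properties using (↗↭↗⇒≋)
open import Data.List.Relation.Binary.Pointwise using (Pointwise-≡⇒≡)
open import Data.List.Relation.Binary.Permutation.Propositional
  using (_↭_; ↭-refl; ↭-sym; ↭-trans; ↭-reflexive; prep; swap; ↭⇒↭ₛ)
open import Data.List.Relation.Binary.Permutation.Propositional.Properties
  using (shift; ∈-resp-↭; All-resp-↭; filter-↭; ↭-length; ↭-reverse)
import Data.List.Relation.Binary.Permutation.Setoid.Properties as Permutationₛ
open import Data.Product using (Σ; ∃; _×_; _,_; proj₂)
open import Data.Sum using (_⊎_; inj₁; inj₂)
open import Data.Empty using (⊥-elim)
open import Function using (_∘_; flip)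
open import Function.Bundles using (_⇔_; mk⇔)
open import Induction.WellFounded using (Acc; acc)
open import Relation.Nullary using (¬_; yes; no; Dec)
open import Relation.Nullary.Decidable using (_×-dec_; ¬?; decidable-stable)
import Relation.Nullary.Decidable as Dec
open import Relation.Binary using (tri<; tri≈; tri>)
open import Relation.Binary.PropositionalEquality

-- Prefix sums and transfers between adjacent positions

psum : ∀ {n} → (Fin n → ℕ) → ℕ → ℕ
psum         f zero    = 0
psum {zero}  f (suc k) = 0
psum {suc n} f (suc k) = f zero + psum (f ∘ suc) k

psum-cong : ∀ {n} {f g : Fin n → ℕ} → (∀ v → f v ≡ g v) → ∀ k → psum f k ≡ psum g k
psum-cong         f≗g zero    = refl
psum-cong {zero}  f≗g (suc k) = refl
psum-cong {suc n} f≗g (suc k) = cong₂ _+_ (f≗g zero) (psum-cong (f≗g ∘ suc) k)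

psum-mono : ∀ {n} (f : Fin n → ℕ) {k l} → k ≤ l → psum f k ≤ psum f l
psum-mono         f {zero}          _         = z≤n
psum-mono {zero}  f {suc k} {suc l} _         = ≤-refl
psum-mono {suc n} f {suc k} {suc l} (s≤s k≤l) = +-monoʳ-≤ (f zero) (psum-mono (f ∘ suc) k≤l)

psum-saturates : ∀ {n} (f : Fin n → ℕ) {k} → n ≤ k → psum f k ≡ psum f n
psum-saturates {zero}  f {zero}  _         = refl
psum-saturates {zero}  f {suc k} _         = refl
psum-saturates {suc n} f {suc k} (s≤s n≤k) = cong (f zero +_) (psum-saturates (f ∘ suc) n≤k)

psum-suc-inject₁ : ∀ {m} (f : Fin (suc m) → ℕ) (i : Fin m) →
  psum f (suc (toℕ i)) ≡ psum f (toℕ i) + f (inject₁ i)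
psum-suc-inject₁ f zero    = +-comm (f zero) 0
psum-suc-inject₁ f (suc i) = begin
  f zero + psum (f ∘ suc) (suc (toℕ i))                   ≡⟨ cong (f zero +_) (psum-suc-inject₁ (f ∘ suc) i) ⟩
  f zero + (psum (f ∘ suc) (toℕ i) + f (suc (inject₁ i))) ≡⟨ +-assoc (f zero) _ _ ⟨
  f zero + psum (f ∘ suc) (toℕ i) + f (suc (inject₁ i))   ∎
  where open ≡-Reasoning

record Transfer {n} (f g : Fin n → ℕ) (x y : Fin n) : Set where
  field
    unchanged : ∀ v → v ≢ x → v ≢ y → g v ≡ f v
    conserved : g x + g y ≡ f x + f y

Transfer-sym : ∀ {n} {f g : Fin n → ℕ} {x y} → Transfer f g x y → Transfer g f x y
Transfer-sym t = record { unchanged = λ v v≢x v≢y → sym (unchanged v v≢x v≢y) ; conserved = sym conserved }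
  where open Transfer t

Transfer-swap : ∀ {n} {f g : Fin n → ℕ} {x y} → Transfer f g x y → Transfer f g y x
Transfer-swap {f = f} {g} {x} {y} t = record
  { unchanged = λ v v≢y v≢x → unchanged v v≢x v≢y
  ; conserved = trans (+-comm (g y) (g x)) (trans conserved (+-comm (f x) (f y)))
  }
  where open Transfer t

record UnitMove {n} (f g : Fin n → ℕ) (x y : Fin n) : Set where
  field
    unchanged : ∀ v → v ≢ x → v ≢ y → g v ≡ f v
    loses     : suc (g x) ≡ f x
    gains     : g y ≡ suc (f y)

UnitMove⇒Transfer : ∀ {n} {f g : Fin n → ℕ} {x y} → UnitMove f g x y → Transfer f g x y
UnitMove⇒Transfer {f = f} {g} {x} {y} move = record { unchanged = unchanged ; conserved = conserved }
  where
  open UnitMove move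
  conserved : g x + g y ≡ f x + f y
  conserved = begin
    g x + g y       ≡⟨ cong (g x +_) gains ⟩
    g x + suc (f y) ≡⟨ +-suc (g x) (f y) ⟩
    suc (g x) + f y ≡⟨ cong (_+ f y) loses ⟩
    f x + f y       ∎
    where open ≡-Reasoning

psum-transfer : ∀ {m} {f g : Fin (suc m) → ℕ} (i : Fin m) → Transfer f g (inject₁ i) (suc i) →
  ∀ k → k ≢ suc (toℕ i) → psum g k ≡ psum f k
psum-transfer i t zero _ = refl
psum-transfer zero t (suc zero) k≢1 = ⊥-elim (k≢1 refl)
psum-transfer {f = f} {g} zero t (suc (suc k)) _ = begin
  g zero + (g (suc zero) + psum g₂ k) ≡⟨ +-assoc (g zero) _ _ ⟨
  g zero + g (suc zero) + psum g₂ k   ≡⟨ cong₂ _+_ conserved (psum-cong rest k) ⟩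
  f zero + f (suc zero) + psum f₂ k   ≡⟨ +-assoc (f zero) _ _ ⟩
  f zero + (f (suc zero) + psum f₂ k) ∎
  where
  open ≡-Reasoning
  open Transfer t
  rest : ∀ v → g (suc (suc v)) ≡ f (suc (suc v))
  rest v = unchanged (suc (suc v)) (λ ()) (λ ())
  f₂ g₂ : _ → ℕ
  f₂ v = f (suc (suc v))
  g₂ v = g (suc (suc v))
psum-transfer (suc i) t (suc k) k≢ =
  cong₂ _+_ (unchanged zero (λ ()) (λ ())) (psum-transfer i tail k (k≢ ∘ cong suc))
  where
  open Transfer t
  tail = record
    { unchanged = λ v v≢i v≢1+i → unchanged (suc v) (v≢i ∘ sucᶠ-injective) (v≢1+i ∘ sucᶠ-injective)
    ; conserved = conserved
    }

Dominates : ∀ {n} → (Fin n → ℕ) → (Fin n → ℕ) → Set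
Dominates {n} a d = (∀ k → psum d k ≤ psum a k) × psum a n ≡ psum d n

Dominates-refl : ∀ {n} {a : Fin n → ℕ} → Dominates a a
Dominates-refl = (λ _ → ≤-refl) , refl

Dominates-trans : ∀ {n} {a b c : Fin n → ℕ} → Dominates a b → Dominates b c → Dominates a c
Dominates-trans (b≤a , a≡b) (c≤b , b≡c) = (λ k → ≤-trans (c≤b k) (b≤a k)) , trans a≡b b≡c

Dominates-tail : ∀ {n} {a d : Fin (suc n) → ℕ} → a zero ≡ d zero → Dominates a d →
  Dominates (a ∘ suc) (d ∘ suc)
Dominates-tail {n} {a} {d} a₀≡d₀ (below , tot) =
  (λ k → +-cancelˡ-≤ (d zero) _ _ (subst (λ x → d zero + psum (d ∘ suc) k ≤ x + psum (a ∘ suc) k)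
                                          a₀≡d₀ (below (suc k)))) ,
  +-cancelˡ-≡ (d zero) _ _ (subst (λ x → x + psum (a ∘ suc) n ≡ d zero + psum (d ∘ suc) n) a₀≡d₀ tot)

sumUpTo : (ℕ → ℕ) → ℕ → ℕ
sumUpTo u zero    = u zero
sumUpTo u (suc n) = sumUpTo u n + u (suc n)

sumUpTo-mono-≤ : ∀ {u v} → (∀ k → u k ≤ v k) → ∀ n → sumUpTo u n ≤ sumUpTo v n
sumUpTo-mono-≤ u≤v zero    = u≤v zero
sumUpTo-mono-≤ u≤v (suc n) = +-mono-≤ (sumUpTo-mono-≤ u≤v n) (u≤v (suc n))

sumUpTo-mono-< : ∀ {u v} → (∀ k → u k ≤ v k) → ∀ {j n} → j ≤ n → u j < v j → sumUpTo u n < sumUpTo v n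
sumUpTo-mono-< u≤v {n = zero}  z≤n   lt = lt
sumUpTo-mono-< u≤v {n = suc n} j≤1+n lt with m≤n⇒m<n∨m≡n j≤1+n
... | inj₁ (s≤s j≤n) = +-mono-<-≤ (sumUpTo-mono-< u≤v j≤n lt) (u≤v (suc n))
... | inj₂ refl      = +-mono-≤-< (sumUpTo-mono-≤ u≤v n) lt

cumulative : ∀ {n} → (Fin n → ℕ) → ℕ
cumulative {n} f = sumUpTo (psum f) n

deficit : ∀ {n} → (Fin n → ℕ) → ℕ
deficit {n} f = sumUpTo (λ k → psum f n ∸ psum f k) n

cumulative-< : ∀ {n} {a d : Fin n → ℕ} {j} → Dominates a d → j ≤ n → psum d j < psum a j →
  cumulative d < cumulative a
cumulative-< (below , _) = sumUpTo-mono-< below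

deficit-< : ∀ {n} {a d : Fin n → ℕ} {j} → Dominates a d → j ≤ n → psum d j < psum a j →
  deficit a < deficit d
deficit-< {n} {a} {d} {j} (below , tot) j≤n lt = sumUpTo-mono-< shortfall j≤n strict
  where
  shortfall : ∀ k → psum a n ∸ psum a k ≤ psum d n ∸ psum d k
  shortfall k = subst (λ t → t ∸ psum a k ≤ psum d n ∸ psum d k) (sym tot) (∸-monoʳ-≤ (psum d n) (below k))
  strict : psum a n ∸ psum a j < psum d n ∸ psum d j
  strict = subst (λ t → t ∸ psum a j < psum d n ∸ psum d j) (sym tot)
    (∸-monoʳ-< lt (subst (psum a j ≤_) tot (psum-mono a j≤n)))

module _ {m} {f g : Fin (suc m) → ℕ} (i : Fin m) (t : Transfer f g (inject₁ i) (suc i)) where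

  transfer-psum-at : psum g (suc (toℕ i)) ≡ psum f (toℕ i) + g (inject₁ i)
  transfer-psum-at =
    trans (psum-suc-inject₁ g i) (cong (_+ g (inject₁ i)) (psum-transfer i t (toℕ i) (1+n≢n ∘ sym)))

  transfer-total : psum g (suc m) ≡ psum f (suc m)
  transfer-total = psum-transfer i t (suc m) (λ eq → <⇒≢ (toℕ<n i) (sym (suc-injective eq)))

  transfer-strict : f (inject₁ i) < g (inject₁ i) → psum f (suc (toℕ i)) < psum g (suc (toℕ i))
  transfer-strict gain =
    subst₂ _<_ (sym (psum-suc-inject₁ f i)) (sym transfer-psum-at) (+-monoʳ-< (psum f (toℕ i)) gain)

  transfer-dominates : f (inject₁ i) ≤ g (inject₁ i) → Dominates g f
  transfer-dominates gain = below , transfer-total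
    where
    below : ∀ k → psum f k ≤ psum g k
    below k with k ℕ.≟ suc (toℕ i)
    ... | yes refl = subst₂ _≤_ (sym (psum-suc-inject₁ f i)) (sym transfer-psum-at)
                       (+-monoʳ-≤ (psum f (toℕ i)) gain)
    ... | no k≢ = ≤-reflexive (sym (psum-transfer i t k k≢))

  transfer-deficit-< : f (inject₁ i) < g (inject₁ i) → deficit g < deficit f
  transfer-deficit-< gain =
    deficit-< (transfer-dominates (<⇒≤ gain)) (s≤s (<⇒≤ (toℕ<n i))) (transfer-strict gain)

  transfer-loss-dominates : ∀ {d} → suc (g (inject₁ i)) ≡ f (inject₁ i) → Dominates f d →
    psum d (suc (toℕ i)) < psum f (suc (toℕ i)) → Dominates g d
  transfer-loss-dominates {d} loss (below , tot) slack = below′ , trans transfer-total tot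
    where
    f≡1+g : psum f (suc (toℕ i)) ≡ suc (psum g (suc (toℕ i)))
    f≡1+g = begin
      psum f (suc (toℕ i))                 ≡⟨ psum-suc-inject₁ f i ⟩
      psum f (toℕ i) + f (inject₁ i)       ≡⟨ cong (psum f (toℕ i) +_) loss ⟨
      psum f (toℕ i) + suc (g (inject₁ i)) ≡⟨ +-suc (psum f (toℕ i)) _ ⟩
      suc (psum f (toℕ i) + g (inject₁ i)) ≡⟨ cong suc transfer-psum-at ⟨
      suc (psum g (suc (toℕ i)))           ∎
      where open ≡-Reasoning
    below′ : ∀ k → psum d k ≤ psum g k
    below′ k with k ℕ.≟ suc (toℕ i)
    ... | yes refl = ≤-pred (subst (psum d k <_) f≡1+g slack)
    ... | no k≢    = subst (psum d k ≤_) (sym (psum-transfer i t k k≢)) (below k)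

transfer-cumulative-< : ∀ {m} {f g : Fin (suc m) → ℕ} (i : Fin m) → Transfer f g (inject₁ i) (suc i) →
  g (inject₁ i) < f (inject₁ i) → cumulative g < cumulative f
transfer-cumulative-< i t loss =
  cumulative-< (transfer-dominates i t⁻¹ (<⇒≤ loss)) (s≤s (<⇒≤ (toℕ<n i))) (transfer-strict i t⁻¹ loss)
  where t⁻¹ = Transfer-sym t

-- A and D are the prefix sums of a and d before the positions considered.
descent-from : ∀ {m} (a d : Fin (suc m) → ℕ) {A D} → D ≤ A → (∀ v → d v < a zero) →
  A + psum a (suc m) ≡ D + psum d (suc m) →
  ∃ λ i → a (suc i) < a (inject₁ i) × D + psum d (suc (toℕ i)) < A + psum a (suc (toℕ i))
descent-from {zero} a d D≤A d<a₀ tot =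
  ⊥-elim (<-irrefl (sym tot) (+-mono-≤-< D≤A (+-monoˡ-< 0 (d<a₀ zero))))
descent-from {suc m} a d {A} {D} D≤A d<a₀ tot with a (suc zero) <? a zero
... | yes drop = zero , drop , +-mono-≤-< D≤A (+-monoˡ-< 0 (d<a₀ zero))
... | no ¬drop =
  let i , drop , gap = descent-from (a ∘ suc) (d ∘ suc) (+-mono-≤ D≤A (<⇒≤ (d<a₀ zero)))
                         (λ v → <-≤-trans (d<a₀ (suc v)) (≮⇒≥ ¬drop))
                         (subst₂ _≡_ (sym (+-assoc A _ _)) (sym (+-assoc D _ _)) tot)
  in suc i , drop , subst₂ _<_ (+-assoc D _ _) (+-assoc A _ _) gap

descent-or-equal : ∀ {m} (a d : Fin (suc m) → ℕ) → WeaklyDecreasing d → Dominates a d →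
  (∀ v → a v ≡ d v) ⊎ ∃ λ i → a (suc i) < a (inject₁ i) × psum d (suc (toℕ i)) < psum a (suc (toℕ i))
descent-or-equal {zero} a d _ (_ , tot) = inj₁ λ { zero → +-cancelʳ-≡ 0 _ _ tot }
descent-or-equal {suc m} a d d↓ (below , tot) with <-cmp (d zero) (a zero)
... | tri< d₀<a₀ _ _ = inj₂ (descent-from a d {0} {0} z≤n (λ v → ≤-<-trans (d↓ zero v z≤n) d₀<a₀) tot)
... | tri> _ _ a₀<d₀ = ⊥-elim (<⇒≱ a₀<d₀ (subst₂ _≤_ (+-identityʳ _) (+-identityʳ _) (below 1)))
... | tri≈ _ d₀≡a₀ _ with descent-or-equal (a ∘ suc) (d ∘ suc) (λ i j i≤j → d↓ (suc i) (suc j) (s≤s i≤j))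
                           (Dominates-tail (sym d₀≡a₀) (below , tot))
...   | inj₁ same             = inj₁ λ { zero → sym d₀≡a₀ ; (suc v) → same v }
...   | inj₂ (i , drop , gap) = inj₂ (suc i , drop , +-mono-≤-< (≤-reflexive d₀≡a₀) gap)

stepwise⇒weaklyDecreasing : ∀ {m} (f : Fin (suc m) → ℕ) → (∀ i → f (suc i) ≤ f (inject₁ i)) →
  WeaklyDecreasing f
stepwise⇒weaklyDecreasing f step zero zero _ = ≤-refl
stepwise⇒weaklyDecreasing {suc m} f step zero (suc j) _ =
  ≤-trans (stepwise⇒weaklyDecreasing (f ∘ suc) (step ∘ suc) zero j z≤n) (step zero)
stepwise⇒weaklyDecreasing {suc m} f step (suc i) (suc j) (s≤s i≤j) =
  stepwise⇒weaklyDecreasing (f ∘ suc) (step ∘ suc) i j i≤j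

-- Majorization of weakly decreasing sequences

sum-take-tabulate : ∀ {n} (f : Fin n → ℕ) k → sum (take k (tabulate f)) ≡ psum f k
sum-take-tabulate         f zero    = refl
sum-take-tabulate {zero}  f (suc k) = refl
sum-take-tabulate {suc n} f (suc k) = cong (f zero +_) (sum-take-tabulate (f ∘ suc) k)

sort-cong : ∀ {xs ys} → xs ↭ ys → sort xs ≡ sort ys
sort-cong {xs} {ys} xs↭ys = Pointwise-≡⇒≡ (↗↭↗⇒≋ ≤-totalOrder (sort-↗ xs) (sort-↗ ys)
  (↭⇒↭ₛ (↭-trans (sort-↭ xs) (↭-trans xs↭ys (↭-sym (sort-↭ ys))))))

AllPairs-reverse : ∀ {xs : List ℕ} → AllPairs (flip _≤_) xs → AllPairs _≤_ (reverse xs)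
AllPairs-reverse {[]}     []           = []
AllPairs-reverse {x ∷ xs} (x≥xs ∷ xs!) rewrite unfold-reverse x xs =
  AllPairs.++⁺ (AllPairs-reverse xs!) (All.[] ∷ [])
    (All.map (λ y≤x → y≤x All.∷ All.[]) (All-resp-↭ (↭-sym (↭-reverse xs)) x≥xs))

decreasingList-weaklyDecreasing : ∀ {n} (a : Fin n → ℕ) → WeaklyDecreasing a → decreasingList a ≡ tabulate a
decreasingList-weaklyDecreasing a a↓ = trans (cong reverse sorted) (reverse-involutive (tabulate a))
  where
  sorted : sort (tabulate a) ≡ reverse (tabulate a)
  sorted = Pointwise-≡⇒≡ (↗↭↗⇒≋ ≤-totalOrder (sort-↗ _)
    (AllPairs⇒Linked (AllPairs-reverse (AllPairs.tabulate⁺-< (λ {i} {j} i<j → a↓ i j (<⇒≤ i<j)))))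
    (↭⇒↭ₛ (↭-trans (sort-↭ _) (↭-sym (↭-reverse _)))))

tabulate-punchIn : ∀ {n} (f : Fin (suc n) → ℕ) k → tabulate f ↭ f k ∷ tabulate (f ∘ punchIn k)
tabulate-punchIn         f zero    = ↭-refl
tabulate-punchIn {suc n} f (suc k) = ↭-trans (prep (f zero) (tabulate-punchIn (f ∘ suc) k)) (swap _ _ ↭-refl)

tabulate-permute : ∀ {n} (f : Fin n → ℕ) (π : Permutation n n) → tabulate (f ∘ (π ⟨$⟩ʳ_)) ↭ tabulate f
tabulate-permute {zero}  f π = ↭-refl
tabulate-permute {suc n} f π = ↭-trans
  (prep _ (↭-trans (↭-reflexive (tabulate-cong (λ j → cong f (punchIn-permute π zero j))))
                   (tabulate-permute (f ∘ punchIn (π ⟨$⟩ʳ zero)) (remove zero π))))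
  (↭-sym (tabulate-punchIn f (π ⟨$⟩ʳ zero)))

topSum-cong : ∀ {n} {f g : Fin n → ℕ} → (∀ v → f v ≡ g v) → ∀ k → topSum k f ≡ topSum k g
topSum-cong f≗g k = cong (λ l → sum (take k (reverse (sort l)))) (tabulate-cong f≗g)

topSum-permute : ∀ {n} (f : Fin n → ℕ) (π : Permutation n n) k → topSum k (f ∘ (π ⟨$⟩ʳ_)) ≡ topSum k f
topSum-permute f π k = cong (λ l → sum (take k (reverse l))) (sort-cong (tabulate-permute f π))

topSum-weaklyDecreasing : ∀ {n} (a : Fin n → ℕ) → WeaklyDecreasing a → ∀ k → topSum k a ≡ psum a k
topSum-weaklyDecreasing a a↓ k =
  trans (cong (sum ∘ take k) (decreasingList-weaklyDecreasing a a↓)) (sum-take-tabulate a k)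

Majorizes-respˡ : ∀ {n} {a a′ b : Fin n → ℕ} → (∀ k → topSum k a ≡ topSum k a′) → Majorizes a b → Majorizes a′ b
Majorizes-respˡ {n} a≈a′ (below , tot) =
  (λ k 1≤k k≤n → ≤-trans (below k 1≤k k≤n) (≤-reflexive (a≈a′ k))) , trans (sym (a≈a′ n)) tot

Majorizes-respʳ : ∀ {n} {a b b′ : Fin n → ℕ} → (∀ k → topSum k b ≡ topSum k b′) → Majorizes a b → Majorizes a b′
Majorizes-respʳ {n} b≈b′ (below , tot) =
  (λ k 1≤k k≤n → ≤-trans (≤-reflexive (sym (b≈b′ k))) (below k 1≤k k≤n)) , trans tot (b≈b′ n)

module _ {n} {a b : Fin n → ℕ} (a↓ : WeaklyDecreasing a) (b↓ : WeaklyDecreasing b) where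

  private
    topSumᵃ : ∀ k → topSum k a ≡ psum a k
    topSumᵃ = topSum-weaklyDecreasing a a↓
    topSumᵇ : ∀ k → topSum k b ≡ psum b k
    topSumᵇ = topSum-weaklyDecreasing b b↓

  Dominates⇒Majorizes : Dominates a b → Majorizes a b
  Dominates⇒Majorizes (below , tot) =
    (λ k _ _ → subst₂ _≤_ (sym (topSumᵇ k)) (sym (topSumᵃ k)) (below k)) ,
    trans (topSumᵃ n) (trans tot (sym (topSumᵇ n)))

  Majorizes⇒Dominates : Majorizes a b → Dominates a b
  Majorizes⇒Dominates (below , tot) = below′ , tot′
    where
    tot′ : psum a n ≡ psum b n
    tot′ = trans (sym (topSumᵃ n)) (trans tot (topSumᵇ n))
    below′ : ∀ k → psum b k ≤ psum a k
    below′ zero = z≤n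
    below′ (suc k) with suc k ≤? n
    ... | yes k<n = subst₂ _≤_ (topSumᵇ (suc k)) (topSumᵃ (suc k)) (below (suc k) (s≤s z≤n) k<n)
    ... | no k≮n  = subst₂ _≤_ (sym (psum-saturates b n≤k)) (sym (psum-saturates a n≤k))
                        (≤-reflexive (sym tot′))
      where n≤k = <⇒≤ (≰⇒> k≮n)

-- Edges and transpositions of adjacent vertices

module _ {n : ℕ} where
  open VecMembership (_≟_ {n}) public using () renaming (_∈_ to _∈ᵥ_; _∉_ to _∉ᵥ_; _∈?_ to _∈ᵥ?_)

Edge : ℕ → ℕ → Set
Edge n r = Vec (Fin n) r

Adjacent : ∀ {n} → Fin n → Fin n → Set
Adjacent a b = toℕ b ≡ suc (toℕ a)

adjacent : ∀ {m} (i : Fin m) → Adjacent (inject₁ i) (suc i)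
adjacent i = cong suc (sym (toℕ-inject₁ i))

data TransposeView {n} (a b k : Fin n) : Fin n → Set where
  at-a  : k ≡ a → TransposeView a b k b
  at-b  : k ≡ b → k ≢ a → TransposeView a b k a
  other : k ≢ a → k ≢ b → TransposeView a b k k

transpose-view : ∀ {n} (a b k : Fin n) → TransposeView a b k (transpose a b k)
transpose-view a b k with k ≟ a
... | yes k≡a = at-a k≡a
... | no k≢a with k ≟ b
...   | yes k≡b = at-b k≡b k≢a
...   | no k≢b  = other k≢a k≢b

transpose-matchˡ : ∀ {n} (a b : Fin n) → transpose a b a ≡ b
transpose-matchˡ a b with transpose a b a | transpose-view a b a
... | _ | at-a _      = refl
... | _ | at-b _ a≢a  = ⊥-elim (a≢a refl)
... | _ | other a≢a _ = ⊥-elim (a≢a refl)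

transpose-matchʳ : ∀ {n} (a b : Fin n) → transpose a b b ≡ a
transpose-matchʳ a b with transpose a b b | transpose-view a b b
... | _ | at-a b≡a    = b≡a
... | _ | at-b _ _    = refl
... | _ | other _ b≢b = ⊥-elim (b≢b refl)

transpose-other : ∀ {n} (a b : Fin n) {k} → k ≢ a → k ≢ b → transpose a b k ≡ k
transpose-other a b {k} k≢a k≢b with transpose a b k | transpose-view a b k
... | _ | at-a k≡a   = ⊥-elim (k≢a k≡a)
... | _ | at-b k≡b _ = ⊥-elim (k≢b k≡b)
... | _ | other _ _  = refl

transpose-comm : ∀ {n} (a b k : Fin n) → transpose a b k ≡ transpose b a k
transpose-comm a b k with transpose a b k | transpose-view a b k
... | _ | at-a refl     = sym (transpose-matchʳ b k)
... | _ | at-b refl _   = sym (transpose-matchˡ k a)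
... | _ | other k≢a k≢b = sym (transpose-other b a k≢b k≢a)

transpose-involutive : ∀ {n} (a b k : Fin n) → transpose a b (transpose a b k) ≡ k
transpose-involutive a b k = trans (cong (transpose a b) (transpose-comm a b k)) (transpose-inverse a b)

transpose-monotone : ∀ {n} {a b x y : Fin n} → Adjacent a b → toℕ x < toℕ y → ¬ (x ≡ a × y ≡ b) →
  toℕ (transpose a b x) < toℕ (transpose a b y)
transpose-monotone {a = a} {b} {x} {y} adj x<y not-ab
  with transpose a b x | transpose-view a b x | transpose a b y | transpose-view a b y
... | _ | at-a refl   | _ | at-a refl   = ⊥-elim (<-irrefl refl x<y)
... | _ | at-a refl   | _ | at-b refl _ = ⊥-elim (not-ab (refl , refl))
... | _ | at-a refl   | _ | other _ y≢b =
  subst (_< toℕ y) (sym adj) (≤∧≢⇒< x<y (λ a+1≡y → y≢b (toℕ-injective (trans (sym a+1≡y) (sym adj)))))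
... | _ | at-b refl _ | _ | at-a refl   = ⊥-elim (<-irrefl refl (<-trans (≤-reflexive (sym adj)) x<y))
... | _ | at-b refl _ | _ | at-b refl _ = ⊥-elim (<-irrefl refl x<y)
... | _ | at-b refl _ | _ | other _ _   = <-trans (≤-reflexive (sym adj)) x<y
... | _ | other _ _   | _ | at-a refl   = <-trans x<y (≤-reflexive (sym adj))
... | _ | other x≢a _ | _ | at-b refl _ = ≤∧≢⇒< (≤-pred (subst (toℕ x <_) adj x<y)) (x≢a ∘ toℕ-injective)
... | _ | other _ _   | _ | other _ _   = x<y

swapEdge : ∀ {n r} → Fin n → Fin n → Edge n r → Edge n r
swapEdge a b = vmap (transpose a b)

module _ {n} {a b : Fin n} where

  ∈-swapEdge⁻ : ∀ {r v} {e : Edge n r} → v ∈ᵥ swapEdge a b e → transpose a b v ∈ᵥ e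
  ∈-swapEdge⁻ {e = x ∷ e} (here refl) = here (transpose-involutive a b x)
  ∈-swapEdge⁻ {e = x ∷ e} (there v∈) = there (∈-swapEdge⁻ v∈)

  ∈-swapEdge⁺ : ∀ {r v} {e : Edge n r} → transpose a b v ∈ᵥ e → v ∈ᵥ swapEdge a b e
  ∈-swapEdge⁺ {v = v} t∈ = subst (_∈ᵥ _) (transpose-involutive a b v) (∈ᵥ-map⁺ (transpose a b) t∈)

  swapEdge-involutive : ∀ {r} (e : Edge n r) → swapEdge a b (swapEdge a b e) ≡ e
  swapEdge-involutive []      = refl
  swapEdge-involutive (x ∷ e) = cong₂ _∷_ (transpose-involutive a b x) (swapEdge-involutive e)

  swapEdge-both : ∀ {r} {e : Edge n r} → a ∈ᵥ swapEdge a b e × b ∈ᵥ swapEdge a b e → a ∈ᵥ e × b ∈ᵥ e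
  swapEdge-both (a∈ , b∈) =
    subst (_∈ᵥ _) (transpose-matchʳ a b) (∈-swapEdge⁻ b∈) , subst (_∈ᵥ _) (transpose-matchˡ a b) (∈-swapEdge⁻ a∈)

swapEdge-strictlyIncreasing : ∀ {n r} {a b : Fin n} {e : Edge n r} → Adjacent a b ⊎ Adjacent b a →
  StrictlyIncreasing e → ¬ (a ∈ᵥ e × b ∈ᵥ e) → StrictlyIncreasing (swapEdge a b e)
swapEdge-strictlyIncreasing (inj₁ adj) e↑ not-both = ascending adj e↑ not-both
  where
  ascending : ∀ {n r} {a b : Fin n} {e : Edge n r} → Adjacent a b →
    StrictlyIncreasing e → ¬ (a ∈ᵥ e × b ∈ᵥ e) → StrictlyIncreasing (swapEdge a b e)
  ascending {a = a} {b} {e} adj e↑ not-both i j i<j =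
    subst₂ (λ u w → toℕ u < toℕ w) (sym (lookup-map i (transpose a b) e)) (sym (lookup-map j (transpose a b) e))
      (transpose-monotone adj (e↑ i j i<j) λ (eᵢ≡a , eⱼ≡b) →
        not-both (subst (_∈ᵥ e) eᵢ≡a (∈-lookup i e) , subst (_∈ᵥ e) eⱼ≡b (∈-lookup j e)))
swapEdge-strictlyIncreasing {a = a} {b} {e} (inj₂ adj) e↑ not-both =
  subst StrictlyIncreasing (map-cong (transpose-comm b a) e)
    (swapEdge-strictlyIncreasing (inj₁ adj) e↑ λ (b∈ , a∈) → not-both (a∈ , b∈))

-- The image of e under the vertex transposition a ↔ b: an edge through both is the same set.
transposeEdge : ∀ {n r} → Fin n → Fin n → Edge n r → Edge n r
transposeEdge a b e with a ∈ᵥ? e ×-dec b ∈ᵥ? e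
... | yes _ = e
... | no _  = swapEdge a b e

module _ {n r : ℕ} {a b : Fin n} where

  transposeEdge-both : ∀ {e : Edge n r} → a ∈ᵥ e → b ∈ᵥ e → transposeEdge a b e ≡ e
  transposeEdge-both {e} a∈ b∈ with a ∈ᵥ? e ×-dec b ∈ᵥ? e
  ... | yes _       = refl
  ... | no not-both = ⊥-elim (not-both (a∈ , b∈))

  transposeEdge-notBoth : ∀ {e : Edge n r} → ¬ (a ∈ᵥ e × b ∈ᵥ e) → transposeEdge a b e ≡ swapEdge a b e
  transposeEdge-notBoth {e} not-both with a ∈ᵥ? e ×-dec b ∈ᵥ? e
  ... | yes both = ⊥-elim (not-both both)
  ... | no _     = refl

  transpose-∈ : ∀ {v} {e : Edge n r} → a ∈ᵥ e → b ∈ᵥ e → v ∈ᵥ e → transpose a b v ∈ᵥ e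
  transpose-∈ {v} a∈ b∈ v∈ with transpose a b v | transpose-view a b v
  ... | _ | at-a _   = b∈
  ... | _ | at-b _ _ = a∈
  ... | _ | other _ _ = v∈

  ∈-transposeEdge⁻ : ∀ {v} {e : Edge n r} → v ∈ᵥ transposeEdge a b e → transpose a b v ∈ᵥ e
  ∈-transposeEdge⁻ {e = e} v∈ with a ∈ᵥ? e ×-dec b ∈ᵥ? e
  ... | yes (a∈ , b∈) = transpose-∈ a∈ b∈ v∈
  ... | no _          = ∈-swapEdge⁻ v∈

  ∈-transposeEdge⁺ : ∀ {v} {e : Edge n r} → transpose a b v ∈ᵥ e → v ∈ᵥ transposeEdge a b e
  ∈-transposeEdge⁺ {v} {e} t∈ with a ∈ᵥ? e ×-dec b ∈ᵥ? e
  ... | yes (a∈ , b∈) = subst (_∈ᵥ e) (transpose-involutive a b v) (transpose-∈ a∈ b∈ t∈)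
  ... | no _          = ∈-swapEdge⁺ t∈

  transposeEdge-involutive : ∀ (e : Edge n r) → transposeEdge a b (transposeEdge a b e) ≡ e
  transposeEdge-involutive e with a ∈ᵥ? e ×-dec b ∈ᵥ? e
  ... | yes (a∈ , b∈) = transposeEdge-both a∈ b∈
  ... | no not-both = trans (transposeEdge-notBoth (not-both ∘ swapEdge-both)) (swapEdge-involutive e)

  transposeEdge-injective : ∀ {e f : Edge n r} → transposeEdge a b e ≡ transposeEdge a b f → e ≡ f
  transposeEdge-injective {e} {f} eq =
    trans (sym (transposeEdge-involutive e)) (trans (cong (transposeEdge a b) eq) (transposeEdge-involutive f))

  transposeEdge-strictlyIncreasing : ∀ {e : Edge n r} → Adjacent a b → StrictlyIncreasing e →
    StrictlyIncreasing (transposeEdge a b e)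
  transposeEdge-strictlyIncreasing {e} adj e↑ with a ∈ᵥ? e ×-dec b ∈ᵥ? e
  ... | yes _       = e↑
  ... | no not-both = swapEdge-strictlyIncreasing (inj₁ adj) e↑ not-both

module _ {n r : ℕ} {v : Fin n} where

  count∋-∷-∈ : ∀ {e : Edge n r} {es} → v ∈ᵥ e → count∋ v (e ∷ es) ≡ suc (count∋ v es)
  count∋-∷-∈ {e} v∈e with v ∈ᵥ? e
  ... | yes _   = refl
  ... | no v∉e = ⊥-elim (v∉e v∈e)

  count∋-∷-∉ : ∀ {e : Edge n r} {es} → v ∉ᵥ e → count∋ v (e ∷ es) ≡ count∋ v es
  count∋-∷-∉ {e} v∉e with v ∈ᵥ? e
  ... | yes v∈e = ⊥-elim (v∉e v∈e)
  ... | no _    = refl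

  count∋-∷-cong : ∀ {e f : Edge n r} {es} → (v ∈ᵥ e → v ∈ᵥ f) → (v ∈ᵥ f → v ∈ᵥ e) →
    count∋ v (e ∷ es) ≡ count∋ v (f ∷ es)
  count∋-∷-cong {e} e⇒f f⇒e with v ∈ᵥ? e
  ... | yes v∈e = sym (count∋-∷-∈ (e⇒f v∈e))
  ... | no v∉e  = sym (count∋-∷-∉ (v∉e ∘ f⇒e))

  count∋-filter : ∀ (es : List (Edge n r)) → count∋ v es ≡ length (filter (v ∈ᵥ?_) es)
  count∋-filter []       = refl
  count∋-filter (e ∷ es) with v ∈ᵥ? e
  ... | yes _ = cong suc (count∋-filter es)
  ... | no _  = count∋-filter es

  count∋-resp-↭ : ∀ {es fs : List (Edge n r)} → es ↭ fs → count∋ v es ≡ count∋ v fs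
  count∋-resp-↭ {es} {fs} es↭fs =
    trans (count∋-filter es) (trans (↭-length (filter-↭ (v ∈ᵥ?_) es↭fs)) (sym (count∋-filter fs)))

count∋-map : ∀ {n r} (f : Edge n r → Edge n r) {u v : Fin n} →
  (∀ {e} → u ∈ᵥ f e → v ∈ᵥ e) → (∀ {e} → v ∈ᵥ e → u ∈ᵥ f e) → ∀ es → count∋ u (map f es) ≡ count∋ v es
count∋-map f to from []       = refl
count∋-map f {u} {v} to from (e ∷ es) with v ∈ᵥ? e
... | yes v∈e = trans (count∋-∷-∈ (from v∈e)) (cong suc (count∋-map f to from es))
... | no v∉e  = trans (count∋-∷-∉ (v∉e ∘ to)) (count∋-map f to from es)

∈⇒↭-∷ : ∀ {A : Set} {x : A} {xs} → x ∈ xs → ∃ λ ys → xs ↭ x ∷ ys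
∈⇒↭-∷ x∈xs with ∈-∃++ x∈xs
... | ys , zs , refl = ys ++ zs , shift _ ys zs

∈-↭∷-tail : ∀ {A : Set} {x y : A} {xs ys} → xs ↭ x ∷ ys → y ∈ xs → y ≢ x → y ∈ ys
∈-↭∷-tail xs↭ y∈xs y≢x with ∈-resp-↭ xs↭ y∈xs
... | Any.here y≡x  = ⊥-elim (y≢x y≡x)
... | Any.there y∈ys = y∈ys

count∋-mono : ∀ {n r} {v : Fin n} {es fs : List (Edge n r)} → Unique es →
  (∀ {e} → e ∈ es → v ∈ᵥ e → e ∈ fs) → count∋ v es ≤ count∋ v fs
count∋-mono {es = []} _ _ = z≤n
count∋-mono {v = v} {e ∷ es} {fs} (e∉es ∷ es!) sub with v ∈ᵥ? e
... | no _    = count∋-mono es! (sub ∘ Any.there)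
... | yes v∈e with ∈⇒↭-∷ (sub (Any.here refl) v∈e)
...   | rest , fs↭ = subst (suc (count∋ v es) ≤_) (trans (sym (count∋-∷-∈ v∈e)) (sym (count∋-resp-↭ fs↭)))
  (s≤s (count∋-mono es! λ e′∈es v∈e′ →
     ∈-↭∷-tail fs↭ (sub (Any.there e′∈es) v∈e′) (λ e′≡e → All.lookup e∉es e′∈es (sym e′≡e))))

-- For b ∉ e, swapEdge a b e replaces a by b in e.
ShiftClosed : ∀ {n r} → Fin n → Fin n → List (Edge n r) → Set
ShiftClosed a b es = ∀ {e} → e ∈ es → a ∈ᵥ e → b ∉ᵥ e → swapEdge a b e ∈ es

transposeEdge-∈ : ∀ {n r} {a b : Fin n} {es : List (Edge n r)} {e} → ShiftClosed a b es → e ∈ es → a ∈ᵥ e →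
  transposeEdge a b e ∈ es
transposeEdge-∈ {a = a} {b} {es} {e} closed e∈ a∈e = by-cases (b ∈ᵥ? e)
  where
  by-cases : Dec (b ∈ᵥ e) → transposeEdge a b e ∈ es
  by-cases (yes b∈e) = subst (_∈ es) (sym (transposeEdge-both a∈e b∈e)) e∈
  by-cases (no b∉e)  = subst (_∈ es) (sym (transposeEdge-notBoth (b∉e ∘ proj₂))) (closed e∈ a∈e b∉e)

-- transposeEdge a b injects the edges through a into the edges through b.
shiftClosed⇒count∋-≤ : ∀ {n r} {a b : Fin n} {es : List (Edge n r)} → Unique es → ShiftClosed a b es →
  count∋ a es ≤ count∋ b es
shiftClosed⇒count∋-≤ {a = a} {b} {es} es! closed =
  subst (_≤ count∋ b es) (count∋-map (transposeEdge a b) to from es)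
    (count∋-mono (Unique.map⁺ transposeEdge-injective es!) inside)
  where
  to : ∀ {e} → b ∈ᵥ transposeEdge a b e → a ∈ᵥ e
  to b∈ = subst (_∈ᵥ _) (transpose-matchʳ a b) (∈-transposeEdge⁻ b∈)
  from : ∀ {e} → a ∈ᵥ e → b ∈ᵥ transposeEdge a b e
  from a∈ = ∈-transposeEdge⁺ (subst (_∈ᵥ _) (sym (transpose-matchʳ a b)) a∈)
  inside : ∀ {f} → f ∈ map (transposeEdge a b) es → b ∈ᵥ f → f ∈ es
  inside f∈ b∈f with ∈-map⁻ (transposeEdge a b) f∈
  ... | e , e∈es , refl = transposeEdge-∈ closed e∈es (to b∈f)

ShiftableEdge : ∀ {n r} → Fin n → Fin n → List (Edge n r) → Set
ShiftableEdge a b es = ∃ λ e → e ∈ es × (a ∈ᵥ e × b ∉ᵥ e × swapEdge a b e ∉ es)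

module _ {n r} (a b : Fin n) (es : List (Edge n r)) where

  open EdgeMembership (≡-dec {n = r} (_≟_ {n})) using () renaming (_∈?_ to _∈ₑ?_)

  shiftable? : Dec (ShiftableEdge a b es)
  shiftable? = Dec.map′ find (λ (e , e∈ , p) → lose e∈ p)
    (Any.any? (λ e → a ∈ᵥ? e ×-dec ¬? (b ∈ᵥ? e) ×-dec ¬? (swapEdge a b e ∈ₑ? es)) es)

  ¬shiftable⇒shiftClosed : ¬ ShiftableEdge a b es → ShiftClosed a b es
  ¬shiftable⇒shiftClosed unshiftable e∈ a∈e b∉e =
    decidable-stable (swapEdge a b _ ∈ₑ? es) λ e′∉ → unshiftable (_ , e∈ , a∈e , b∉e , e′∉)

transpose-Transfer : ∀ {n} {f g : Fin n → ℕ} {a b : Fin n} → (∀ v → g v ≡ f (transpose a b v)) → Transfer f g a b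
transpose-Transfer {f = f} {g} {a} {b} g≡f∘τ = record
  { unchanged = λ v v≢a v≢b → trans (g≡f∘τ v) (cong f (transpose-other a b v≢a v≢b))
  ; conserved = trans (cong₂ _+_ (trans (g≡f∘τ a) (cong f (transpose-matchˡ a b)))
                                 (trans (g≡f∘τ b) (cong f (transpose-matchʳ a b))))
                      (+-comm (f b) (f a))
  }

transposeVertices : ∀ {n r} (G : RGraph n r) {a b : Fin n} → Adjacent a b →
  Σ (RGraph n r) λ G′ → ∀ v → degree G′ v ≡ degree G (transpose a b v)
transposeVertices {n} {r} G {a} {b} adj =
  G′ , λ v → count∋-map (transposeEdge a b) ∈-transposeEdge⁻ ∈-transposeEdge⁺ (edges G)
  where
  G′ : RGraph n r
  G′ = record
    { edges  = map (transposeEdge a b) (edges G)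
    ; rsets  = All.map⁺ (All.map (λ {e} → transposeEdge-strictlyIncreasing {e = e} adj) (rsets G))
    ; unique = Unique.map⁺ transposeEdge-injective (unique G)
    }

shiftEdge : ∀ {n r} (G : RGraph n r) {a b : Fin n} → Adjacent a b ⊎ Adjacent b a → ShiftableEdge a b (edges G) →
  Σ (RGraph n r) λ G′ → UnitMove (degree G) (degree G′) a b
shiftEdge {n} {r} G {a} {b} adj (e , e∈ , a∈e , b∉e , e′∉) with ∈⇒↭-∷ e∈
... | rest , es↭ = G′ , move
  where
  e′ = swapEdge a b e
  rsets′ : All StrictlyIncreasing (e ∷ rest)
  rsets′ = All-resp-↭ es↭ (rsets G)
  unique′ : Unique (e ∷ rest)
  unique′ = Permutationₛ.Unique-resp-↭ (setoid _) (↭⇒↭ₛ es↭) (unique G)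
  G′ : RGraph n r
  G′ = record
    { edges  = e′ ∷ rest
    ; rsets  = swapEdge-strictlyIncreasing adj (All.head rsets′) (b∉e ∘ proj₂) ∷ All.tail rsets′
    ; unique = All.tabulate (λ f∈rest e′≡f → e′∉ (subst (_∈ edges G) (sym e′≡f)
                                                    (∈-resp-↭ (↭-sym es↭) (Any.there f∈rest))))
               ∷ AllPairs.tail unique′
    }
  split : ∀ v → degree G v ≡ count∋ v (e ∷ rest)
  split v = count∋-resp-↭ es↭
  a∉e′ : a ∉ᵥ e′
  a∉e′ a∈ = b∉e (subst (_∈ᵥ e) (transpose-matchˡ a b) (∈-swapEdge⁻ a∈))
  b∈e′ : b ∈ᵥ e′
  b∈e′ = ∈-swapEdge⁺ (subst (_∈ᵥ e) (sym (transpose-matchʳ a b)) a∈e)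
  move : UnitMove (degree G) (degree G′) a b
  move = record
    { unchanged = λ v v≢a v≢b → let fixed = transpose-other a b v≢a v≢b in
        sym (trans (split v) (count∋-∷-cong (∈-swapEdge⁺ ∘ subst (_∈ᵥ e) (sym fixed))
                                            (subst (_∈ᵥ e) fixed ∘ ∈-swapEdge⁻)))
    ; loses = trans (cong suc (count∋-∷-∉ a∉e′)) (sym (trans (split a) (count∋-∷-∈ a∈e)))
    ; gains = trans (count∋-∷-∈ b∈e′) (cong suc (sym (trans (split b) (count∋-∷-∉ b∉e))))
    }

-- Ideals are the graphs closed under elementary shifts

transpose-descends : ∀ {n} {a b x : Fin n} → Adjacent a b → x ≢ a → toℕ (transpose b a x) ≤ toℕ x
transpose-descends {a = a} {b} {x} adj x≢a with transpose b a x | transpose-view b a x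
... | _ | at-a refl  = ≤-trans (n≤1+n (toℕ a)) (≤-reflexive (sym adj))
... | _ | at-b x≡a _ = ⊥-elim (x≢a x≡a)
... | _ | other _ _  = ≤-refl

swapEdge-≤S : ∀ {n r} {a b : Fin n} {e : Edge n r} → Adjacent a b → a ∉ᵥ e → swapEdge b a e ≤S e
swapEdge-≤S {a = a} {b} {e} adj a∉e i =
  subst (λ u → toℕ u ≤ toℕ (lookup e i)) (sym (lookup-map i (transpose b a) e))
    (transpose-descends adj (λ eᵢ≡a → a∉e (subst (_∈ᵥ e) eᵢ≡a (∈-lookup i e))))

ideal⇒shiftClosed : ∀ {m r} (G : RGraph (suc m) r) → IsIdeal G → ∀ i → ShiftClosed (suc i) (inject₁ i) (edges G)
ideal⇒shiftClosed G ideal i {e} e∈ _ a∉e =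
  ideal _ e (swapEdge-strictlyIncreasing (inj₂ (adjacent i)) (All.lookup (rsets G) e∈) (a∉e ∘ proj₂)) e∈
    (swapEdge-≤S (adjacent i) a∉e)

ideal⇒weaklyDecreasing : ∀ {m r} (G : RGraph (suc m) r) → IsIdeal G → WeaklyDecreasing (degree G)
ideal⇒weaklyDecreasing G ideal =
  stepwise⇒weaklyDecreasing (degree G) (λ i → shiftClosed⇒count∋-≤ (unique G) (ideal⇒shiftClosed G ideal i))

entrySum : ∀ {n r} → Edge n r → ℕ
entrySum []      = 0
entrySum (x ∷ e) = toℕ x + entrySum e

entrySum-mono-≤ : ∀ {n r} {e f : Edge n r} → e ≤S f → entrySum e ≤ entrySum f
entrySum-mono-≤ {e = []}    {[]}    _   = z≤n
entrySum-mono-≤ {e = x ∷ e} {y ∷ f} e≤f = +-mono-≤ (e≤f zero) (entrySum-mono-≤ {e = e} {f} (e≤f ∘ suc))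

entrySum-mono-< : ∀ {n r} {e f : Edge n r} → e ≤S f → ∀ k → toℕ (lookup e k) < toℕ (lookup f k) →
  entrySum e < entrySum f
entrySum-mono-< {e = x ∷ e} {y ∷ f} e≤f zero    lt = +-mono-<-≤ lt (entrySum-mono-≤ {e = e} {f} (e≤f ∘ suc))
entrySum-mono-< {e = x ∷ e} {y ∷ f} e≤f (suc k) lt =
  +-mono-≤-< (e≤f zero) (entrySum-mono-< {e = e} {f} (e≤f ∘ suc) k lt)

strictlyIncreasing-injective : ∀ {n r} {e : Edge n r} → StrictlyIncreasing e →
  ∀ {j k} → lookup e j ≡ lookup e k → j ≡ k
strictlyIncreasing-injective e↑ {j} {k} eⱼ≡eₖ with <-cmp (toℕ j) (toℕ k)
... | tri< j<k _ _ = ⊥-elim (<-irrefl (cong toℕ eⱼ≡eₖ) (e↑ j k j<k))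
... | tri≈ _ j≡k _ = toℕ-injective j≡k
... | tri> _ _ k<j = ⊥-elim (<-irrefl (cong toℕ (sym eⱼ≡eₖ)) (e↑ k j k<j))

firstExcess : ∀ {n r} (X Y : Edge n r) → X ≤S Y →
  X ≡ Y ⊎ ∃ λ k → toℕ (lookup X k) < toℕ (lookup Y k) × (∀ j → toℕ j < toℕ k → lookup X j ≡ lookup Y j)
firstExcess []      []      _   = inj₁ refl
firstExcess (x ∷ X) (y ∷ Y) X≤Y with toℕ x <? toℕ y
... | yes x<y = inj₂ (zero , x<y , λ _ ())
... | no x≮y with toℕ-injective (≤-antisym (X≤Y zero) (≮⇒≥ x≮y))
...   | refl with firstExcess X Y (X≤Y ∘ suc)
...     | inj₁ refl = inj₁ refl
...     | inj₂ (k , excess , agree) = inj₂ (suc k , excess , λ { zero _ → refl ; (suc j) (s≤s j<k) → agree j j<k })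

-- At the first position k where X lies below Y, the value Yₖ - 1 does not occur in Y, so
-- lowering Yₖ by one is an elementary shift, and the result still lies above X.
module LowerFirstExcess {m r} {X Y : Edge (suc m) r} (X↑ : StrictlyIncreasing X) (Y↑ : StrictlyIncreasing Y)
  (X≤Y : X ≤S Y) {k : Fin r} (excess : toℕ (lookup X k) < toℕ (lookup Y k))
  (agree : ∀ j → toℕ j < toℕ k → lookup X j ≡ lookup Y j) {i : Fin m} (Yₖ≡ : lookup Y k ≡ suc i) where

  i<1+i : toℕ (inject₁ i) < toℕ (suc i)
  i<1+i = ≤-reflexive (sym (adjacent i))

  Xₖ≤i : toℕ (lookup X k) ≤ toℕ i
  Xₖ≤i = ≤-pred (subst (λ y → toℕ (lookup X k) < toℕ y) Yₖ≡ excess)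

  predecessor-∉ : inject₁ i ∉ᵥ Y
  predecessor-∉ i∈Y with index i∈Y | lookup-index i∈Y
  ... | j | i≡Yⱼ with <-cmp (toℕ j) (toℕ k)
  ...   | tri< j<k _ _ = <-irrefl refl (<-≤-trans (X↑ j k j<k) (≤-trans Xₖ≤i (≤-reflexive (sym Xⱼ≡i))))
    where
    Xⱼ≡i : toℕ (lookup X j) ≡ toℕ i
    Xⱼ≡i = trans (cong toℕ (trans (agree j j<k) (sym i≡Yⱼ))) (toℕ-inject₁ i)
  ...   | tri≈ _ j≡k _ = <-irrefl (cong toℕ (trans i≡Yⱼ (trans (cong (lookup Y) (toℕ-injective j≡k)) Yₖ≡)))
                                  i<1+i
  ...   | tri> _ _ k<j = <-asym (subst₂ (λ u w → toℕ u < toℕ w) Yₖ≡ (sym i≡Yⱼ) (Y↑ k j k<j)) i<1+i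

  lowered : Edge (suc m) r
  lowered = swapEdge (suc i) (inject₁ i) Y

  lowered-≤S : lowered ≤S Y
  lowered-≤S = swapEdge-≤S {e = Y} (adjacent i) predecessor-∉

  ≤S-lowered : X ≤S lowered
  ≤S-lowered j =
    subst (λ u → toℕ (lookup X j) ≤ toℕ u) (sym (lookup-map j (transpose (suc i) (inject₁ i)) Y)) bound
    where
    bound : toℕ (lookup X j) ≤ toℕ (transpose (suc i) (inject₁ i) (lookup Y j))
    bound with transpose (suc i) (inject₁ i) (lookup Y j) | transpose-view (suc i) (inject₁ i) (lookup Y j)
    ... | _ | at-a Yⱼ≡ = subst (λ l → toℕ (lookup X l) ≤ toℕ (inject₁ i))
                           (strictlyIncreasing-injective {e = Y} Y↑ (trans Yₖ≡ (sym Yⱼ≡)))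
                           (≤-trans Xₖ≤i (≤-reflexive (sym (toℕ-inject₁ i))))
    ... | _ | at-b Yⱼ≡i _ = ⊥-elim (predecessor-∉ (subst (_∈ᵥ Y) Yⱼ≡i (∈-lookup j Y)))
    ... | _ | other _ _ = X≤Y j

  lowered-at : lookup lowered k ≡ inject₁ i
  lowered-at = begin
    lookup lowered k                                 ≡⟨ lookup-map k (transpose (suc i) (inject₁ i)) Y ⟩
    transpose (suc i) (inject₁ i) (lookup Y k)      ≡⟨ cong (transpose (suc i) (inject₁ i)) Yₖ≡ ⟩
    transpose (suc i) (inject₁ i) (suc i)           ≡⟨ transpose-matchˡ (suc i) (inject₁ i) ⟩
    inject₁ i                                        ∎
    where open ≡-Reasoning

  entrySum-lowered : entrySum lowered < entrySum Y
  entrySum-lowered = entrySum-mono-< {e = lowered} {Y} lowered-≤S k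
    (subst₂ (λ u w → toℕ u < toℕ w) (sym lowered-at) (sym Yₖ≡) i<1+i)

nonzero⇒suc : ∀ {m x} (b : Fin (suc m)) → x < toℕ b → ∃ λ i → b ≡ suc i
nonzero⇒suc (suc i) _ = i , refl

shiftClosed⇒ideal : ∀ {m r} (G : RGraph (suc m) r) → (∀ i → ShiftClosed (suc i) (inject₁ i) (edges G)) →
  IsIdeal G
shiftClosed⇒ideal G closed X Y X↑ Y∈ X≤Y = descend Y (<-wellFounded (entrySum Y)) Y∈ X≤Y
  where
  descend : ∀ Y → Acc _<_ (entrySum Y) → Y ∈ edges G → X ≤S Y → X ∈ edges G
  descend Y (acc smaller) Y∈ X≤Y with firstExcess X Y X≤Y
  ... | inj₁ refl = Y∈
  ... | inj₂ (k , excess , agree) =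
    let i , Yₖ≡ = nonzero⇒suc (lookup Y k) excess
        open LowerFirstExcess {X = X} {Y} X↑ (All.lookup (rsets G) Y∈) X≤Y excess agree Yₖ≡
    in descend lowered (smaller entrySum-lowered)
         (closed i Y∈ (subst (_∈ᵥ Y) Yₖ≡ (∈-lookup k Y)) predecessor-∉) ≤S-lowered

-- Normalising a graph by local moves

sortDegrees : ∀ {m r} (G : RGraph (suc m) r) → Acc _<_ (deficit (degree G)) →
  Σ (RGraph (suc m) r) λ G′ → WeaklyDecreasing (degree G′) × (∀ k → topSum k (degree G′) ≡ topSum k (degree G))
sortDegrees G (acc smaller) with any? (λ i → degree G (inject₁ i) <? degree G (suc i))
... | no sorted = G , stepwise⇒weaklyDecreasing (degree G) (λ i → ≮⇒≥ (sorted ∘ (i ,_))) , λ _ → refl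
... | yes (i , inversion) =
  let G₁ , relabelled = transposeVertices G (adjacent i)
      gain = subst (degree G (inject₁ i) <_)
               (sym (trans (relabelled _) (cong (degree G) (transpose-matchˡ (inject₁ i) (suc i))))) inversion
      G′ , sorted , same = sortDegrees G₁ (smaller (transfer-deficit-< i (transpose-Transfer relabelled) gain))
  in G′ , sorted , λ k → trans (same k) (trans (topSum-cong relabelled k)
                                                (topSum-permute (degree G) (Permutation.transpose (inject₁ i) (suc i)) k))

shiftToIdeal : ∀ {m r} (G : RGraph (suc m) r) → Acc _<_ (deficit (degree G)) →
  Σ (RGraph (suc m) r) λ H → IsIdeal H × Dominates (degree H) (degree G)
shiftToIdeal G (acc smaller) with any? (λ i → shiftable? (suc i) (inject₁ i) (edges G))
... | no closed = G , shiftClosed⇒ideal G (λ i → ¬shiftable⇒shiftClosed _ _ _ (closed ∘ (i ,_))) , Dominates-refl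
... | yes (i , shiftable) =
  let G₁ , move = shiftEdge G (inj₂ (adjacent i)) shiftable
      t = Transfer-swap (UnitMove⇒Transfer move)
      gain = ≤-reflexive (sym (UnitMove.gains move))
      H , ideal , dominates = shiftToIdeal G₁ (smaller (transfer-deficit-< i t gain))
  in H , ideal , Dominates-trans dominates (transfer-dominates i t (<⇒≤ gain))

realiseDominated : ∀ {m r} (d : Fin (suc m) → ℕ) → WeaklyDecreasing d → (G : RGraph (suc m) r) →
  Acc _<_ (cumulative (degree G)) → Dominates (degree G) d → Σ (RGraph (suc m) r) λ G′ → ∀ v → degree G′ v ≡ d v
realiseDominated d d↓ G (acc smaller) dominates with descent-or-equal (degree G) d d↓ dominates
... | inj₁ realised = G , realised
... | inj₂ (i , drop , slack) with shiftable? (inject₁ i) (suc i) (edges G)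
...   | no unshiftable =
  ⊥-elim (<⇒≱ drop (shiftClosed⇒count∋-≤ (unique G) (¬shiftable⇒shiftClosed _ _ _ unshiftable)))
...   | yes shiftable =
  let G₁ , move = shiftEdge G (inj₁ (adjacent i)) shiftable
      t = UnitMove⇒Transfer move
      loss = UnitMove.loses move
  in realiseDominated d d↓ G₁ (smaller (transfer-cumulative-< i t (≤-reflexive loss)))
       (transfer-loss-dominates i t loss dominates slack)

theorem1p5 : (n r : ℕ) → 1 ≤ n → 1 ≤ r → (d : Fin n → ℕ) → WeaklyDecreasing d →
    (Σ (RGraph n r) (λ G → IsDegreePartitionOf d G))
      ⇔ (Σ (Fin n → ℕ) (λ p → IsRIdealPartition n r p × Majorizes p d))
theorem1p5 zero    _ ()  _ _ _
theorem1p5 (suc m) r _ _ d d↓ = mk⇔ majorized realised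
  where
  majorized : Σ (RGraph (suc m) r) (IsDegreePartitionOf d) →
              Σ (Fin (suc m) → ℕ) λ p → IsRIdealPartition (suc m) r p × Majorizes p d
  majorized (G , _ , σ , d≡Gσ) =
    let G′ , G′↓ , G′≈G = sortDegrees G (<-wellFounded _)
        H , ideal , H≽G′ = shiftToIdeal G′ (<-wellFounded _)
        G′≈d k = trans (G′≈G k) (trans (sym (topSum-permute (degree G) σ k)) (sym (topSum-cong d≡Gσ k)))
    in degree H , (H , ideal , λ _ → refl) ,
       Majorizes-respʳ {a = degree H} {degree G′} {d} G′≈d
         (Dominates⇒Majorizes (ideal⇒weaklyDecreasing H ideal) G′↓ H≽G′)

  realised : Σ (Fin (suc m) → ℕ) (λ p → IsRIdealPartition (suc m) r p × Majorizes p d) →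
             Σ (RGraph (suc m) r) (IsDegreePartitionOf d)
  realised (p , (H , ideal , p≡H) , p≽d) =
    let H≽d = Majorizes⇒Dominates (ideal⇒weaklyDecreasing H ideal) d↓
                (Majorizes-respˡ {a = p} {degree H} {d} (topSum-cong p≡H) p≽d)
        G , G≡d = realiseDominated d d↓ H (<-wellFounded _) H≽d
    in G , d↓ , Permutation.id , sym ∘ G≡d
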